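{- For every positive integer $n$, $\operatorname{pqn}(K_{n,n}) \ge \left\lceil \frac{3-\sqrt{5}}{4}\, n\right\rceil$, where $K_{n,n}$ is the complete bipartite graph with both classes of size $n$.
   Context: All graphs are finite, simple and undirected. An edge-weighted graph $\langle G,w\rangle$ is a graph $G=(V,E)$ with $w\colon E\to\mathbb{R}$. A PQ-layout of $\langle G,w\rangle$ with $k$ priority queues consists of a linear ordering $\prec$ of $V$ and a partition of $E$ into $k$ sets $\mathcal{P}_1,\dots,\mathcal{P}_k$ such that there is no $i$ and no two edges $e=uv$, $e'=u'v'$ in $\mathcal{P}_i$ with $w(e)>w(e')$ and $u\prec v$, $u'\prec v$, $v\prec v'$. $\operatorname{pqn}(G,w)$ is the minimum $k\ge0$ such that $\langle G,w\rangle$ has a PQ-layout with $k$ priority queues, and $\operatorname{pqn}(G)$ is the minimum $k\ge0$ such that $\operatorname{pqn}(G,w)\le k$ for every $w\colon E\to\mathbb{R}$. -}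

module Defs where

open import Data.Nat using (ℕ; zero; suc; _+_; _*_; _∸_; _^_; _≤_; _<_)
open import Data.Fin using (Fin)
open import Data.Sum using (_⊎_; inj₁; inj₂)
open import Data.Product using (Σ; _×_; _,_; proj₁; proj₂)
open import Relation.Nullary using (¬_)
open import Relation.Binary.PropositionalEquality using (_≡_)
open import Function.Definitions using (Injective)

-- Edges are unordered: an edge e = uv may be read either way (see IsEnds).
record Graph : Set₁ where
  field
    V    : Set
    E    : Set
    ends : E → V × V

open Graph public

IsEnds : (G : Graph) → E G → V G → V G → Set
IsEnds G e u v =
  (proj₁ (ends G e) ≡ u × proj₂ (ends G e) ≡ v) ⊎
  (proj₁ (ends G e) ≡ v × proj₂ (ends G e) ≡ u)

-- A PQ-layout of ⟨G,w⟩ with k priority queues: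
-- a linear order on V (given by an injective position map pos : V → ℕ,
-- u ≺ v iff pos u < pos v) and a partition of E into k classes
-- (given by q : E → Fin k), such that there are no two edges e = uv,
-- e' = u'v' in the same class with w(e) > w(e') and u ≺ v, u' ≺ v, v ≺ v'.
HasPQLayout : (G : Graph) → (E G → ℕ) → ℕ → Set
HasPQLayout G w k =
  Σ (V G → ℕ) λ pos → Injective _≡_ _≡_ pos ×
  Σ (E G → Fin k) λ q →
    ∀ (e e' : E G) (u v u' v' : V G) →
    q e ≡ q e' → IsEnds G e u v → IsEnds G e' u' v' →
    pos u < pos v → pos u' < pos v → pos v < pos v' →
    ¬ (w e' < w e)

-- pqn(G) ≤ k : every weighting of the edges admits a PQ-layout with k queues.
-- (Weights in ℕ: only the relative order of the finitely many weights matters.)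
PqnAtMost : Graph → ℕ → Set
PqnAtMost G k = ∀ (w : E G → ℕ) → HasPQLayout G w k

K : ℕ → Graph
K n = record
  { V    = Fin n ⊎ Fin n
  ; E    = Fin n × Fin n
  ; ends = λ ij → inj₁ (proj₁ ij) , inj₂ (proj₂ ij)
  }

-- For m n : ℕ,  m ≥ ((3 - √5)/4) n  ⟺  √5 n ≥ 3n - 4m  ⟺  (3n ∸ 4m)² ≤ 5 n².
GeConst : ℕ → ℕ → Set
GeConst n m = (3 * n ∸ 4 * m) ^ 2 ≤ 5 * n ^ 2

-- m = ⌈ ((3 - √5)/4) n ⌉ : the least natural number m with m ≥ ((3 - √5)/4) n
-- (the quantity is ≥ 0, so the ceiling is a natural number).
IsCeilConst : ℕ → ℕ → Set
IsCeilConst n m = GeConst n m × (∀ m' → GeConst n m' → m ≤ m')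

-- Split the vertices of K_{n,n} into the four classes L₀, R₀, L₁, R₁ of left and right
-- vertices with even and odd index, arranged in the cycle L₀ → R₀ → L₁ → R₁ → L₀.  Every
-- edge joins two consecutive classes X → Y; weight it by the index of its endpoint in X.
-- If k+1 vertices of X precede position c and k+1 vertices of Y do not, pairing the former
-- by decreasing index with the latter by increasing position yields k+1 edges no two of
-- which may share a queue.  Now suppose every class has at least 2k+1 vertices, and let c
-- be the first position by which some class X has k+1 vertices placed.  Then at most k
-- vertices of the next class Y come later, so Y too has its (k+1)-st vertex at position c,
-- which is impossible.  Hence n ≤ 4k+1 ≤ 5k, and 1/5 > (3 - √5)/4.
module Submission where

open import Defs
open import Level using (Level; 0ℓ) renaming (_⊔_ to _⊔ˡ_)
open import Data.Nat
  using (ℕ; zero; suc; _+_; _*_; _∸_; _^_; _≤_; _<_; _⊔_; z≤n; s≤s; s≤s⁻¹; s<s⁻¹; _≤?_; _<?_;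
         ⌊_/2⌋; ⌈_/2⌉; parity; >-nonZero⁻¹)
open import Data.Nat.Properties
  using (≤-trans; ≤-antisym; ≤-reflexive; <-≤-trans; ≤-<-trans; ≮⇒≥; ≰⇒>; <⇒≱; n≮0;
         n<1+n; n≤1+n; m≤n⇒m≤1+n; m≤m+n; m≤m⊔n; m≤n⊔m; +-suc; +-comm; +-monoʳ-≤; +-cancelʳ-≤;
         *-assoc; *-distribʳ-+; *-distribˡ-∸; *-monoʳ-≤; *-monoˡ-≤; *-cancelˡ-≤; ∸-monoʳ-≤;
         m+n∸n≡m; ^-monoˡ-≤; ⌊n/2⌋-mono; ⌊n/2⌋≤⌈n/2⌉; n≡⌊n+n/2⌋;
         <-strictTotalOrder; module ≤-Reasoning)
open import Data.Nat.Tactic.RingSolver using (solve-∀)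
open import Data.Parity using (Parity; 0ℙ; 1ℙ; _⁻¹)
open import Data.Parity.Properties using (suc-homo-⁻¹; ⁻¹-selfInverse; p≢p⁻¹)
import Data.Parity.Properties as ℙ
open import Data.Fin using (Fin; zero; suc; toℕ; fromℕ<; _≟_)
import Data.Fin as Fin
open import Data.Fin.Properties using (any?; suc-injective; toℕ-injective; pigeonhole; nonZeroIndex)
open import Data.Sum using (inj₁; inj₂)
open import Data.Sum.Properties using (inj₁-injective; inj₂-injective)
open import Data.Product using (_×_; _,_; ∃; proj₁; proj₂; map)
open import Data.Empty using (⊥; ⊥-elim)
open import Function using (_∘_; id)
open import Function.Definitions using (Injective)
open import Relation.Nullary using (¬_; yes; no)
open import Relation.Unary using (Pred; Decidable; ∁; _∩_; _⊆_; _∈_; _∉_)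
open import Relation.Unary.Properties using (∁?; _∩?_)
open import Relation.Binary using (StrictTotalOrder; tri<; tri≈; tri>)
import Relation.Binary.Construct.Flip.EqAndOrd as Flip
open import Relation.Binary.PropositionalEquality using (_≡_; _≢_; refl; sym; trans; cong; subst; subst₂)

private variable
  ℓ ℓ′ : Level
  n : ℕ

count : {P : Pred (Fin n) ℓ} → Decidable P → ℕ
count {n = zero}  P? = 0
count {n = suc n} P? with P? zero
... | yes _ = suc (count (P? ∘ suc))
... | no  _ = count (P? ∘ suc)

count-mono : {P : Pred (Fin n) ℓ} {Q : Pred (Fin n) ℓ′} (P? : Decidable P) (Q? : Decidable Q) →
             P ⊆ Q → count P? ≤ count Q?
count-mono {n = zero}  P? Q? P⊆Q = z≤n
count-mono {n = suc n} P? Q? P⊆Q with P? zero | Q? zero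
... | yes _ | yes _ = s≤s (count-mono (P? ∘ suc) (Q? ∘ suc) P⊆Q)
... | yes p | no ¬q = ⊥-elim (¬q (P⊆Q p))
... | no  _ | yes _ = m≤n⇒m≤1+n (count-mono (P? ∘ suc) (Q? ∘ suc) P⊆Q)
... | no  _ | no  _ = count-mono (P? ∘ suc) (Q? ∘ suc) P⊆Q

count-cong : {P : Pred (Fin n) ℓ} {Q : Pred (Fin n) ℓ′} (P? : Decidable P) (Q? : Decidable Q) →
             P ⊆ Q → Q ⊆ P → count P? ≡ count Q?
count-cong P? Q? P⊆Q Q⊆P = ≤-antisym (count-mono P? Q? P⊆Q) (count-mono Q? P? Q⊆P)

count-split : {P : Pred (Fin n) ℓ} {Q : Pred (Fin n) ℓ′} (P? : Decidable P) (Q? : Decidable Q) →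
              count P? ≡ count (P? ∩? Q?) + count (P? ∩? ∁? Q?)
count-split {n = zero}  P? Q? = refl
count-split {n = suc n} P? Q? with P? zero | Q? zero
... | yes _ | yes _ = cong suc (count-split (P? ∘ suc) (Q? ∘ suc))
... | yes _ | no  _ = trans (cong suc (count-split (P? ∘ suc) (Q? ∘ suc))) (sym (+-suc _ _))
... | no  _ | _     = count-split (P? ∘ suc) (Q? ∘ suc)

count-remove : {P : Pred (Fin n) ℓ} (P? : Decidable P) {x : Fin n} → x ∈ P →
               count P? ≡ suc (count (P? ∩? ∁? (_≟ x)))
count-remove {n = suc n} P? {zero} p₀ with P? zero
... | yes _  = cong suc (count-cong (P? ∘ suc) _ (λ p → p , λ ()) proj₁)
... | no ¬p₀ = ⊥-elim (¬p₀ p₀)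
count-remove {n = suc n} P? {suc x} pₓ
  with P? zero
     | trans (count-remove (P? ∘ suc) pₓ)
             (cong suc (count-cong ((P? ∘ suc) ∩? ∁? (_≟ x)) ((P? ∩? ∁? (_≟ suc x)) ∘ suc)
                                   (map id (_∘ suc-injective)) (map id (_∘ cong suc))))
... | yes _ | tail = cong suc tail
... | no  _ | tail = tail

count<count⇒∃ : {P : Pred (Fin n) ℓ} {Q : Pred (Fin n) ℓ′} (P? : Decidable P) (Q? : Decidable Q) →
                count P? < count Q? → ∃ λ i → i ∉ P × i ∈ Q
count<count⇒∃ {n = suc n} P? Q? lt with P? zero | Q? zero
... | no ¬p | yes q = zero , ¬p , q
... | yes _ | yes _ = map suc id (count<count⇒∃ (P? ∘ suc) (Q? ∘ suc) (s<s⁻¹ lt))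
... | yes _ | no  _ = map suc id (count<count⇒∃ (P? ∘ suc) (Q? ∘ suc) (≤-trans (n≤1+n _) lt))
... | no  _ | no  _ = map suc id (count<count⇒∃ (P? ∘ suc) (Q? ∘ suc) lt)

0<count⇒∃ : {P : Pred (Fin n) ℓ} (P? : Decidable P) → 0 < count P? → ∃ P
0<count⇒∃ {n = suc n} P? pos with P? zero
... | yes p = zero , p
... | no  _ = map suc id (0<count⇒∃ (P? ∘ suc) pos)

upper-bound : (f : Fin n → ℕ) → ∃ λ M → ∀ i → f i < M
upper-bound {n = zero}  f = 0 , λ ()
upper-bound {n = suc n} f with upper-bound (f ∘ suc)
... | M , below = suc (f zero) ⊔ M , λ { zero    → m≤m⊔n _ M
                                     ; (suc i) → <-≤-trans (below i) (m≤n⊔m _ M) }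

module _ {s ℓ₁ ℓ₂} (S : StrictTotalOrder s ℓ₁ ℓ₂) where

  open StrictTotalOrder S using (_≈_; irrefl; compare; module Eq)
    renaming (Carrier to A; _<_ to _⊏_; _<?_ to _⊏?_; trans to ⊏-trans)

  Minimal : (Fin n → A) → Pred (Fin n) ℓ → Pred (Fin n) (ℓ ⊔ˡ ℓ₂)
  Minimal key P x = x ∈ P × ∀ {y} → y ∈ P → ¬ key y ⊏ key x

  minimum : {P : Pred (Fin n) ℓ} (key : Fin n → A) → Decidable P → ∃ P → ∃ (Minimal key P)
  minimum {n = suc n} {P = P} key P? ∃P with any? (P? ∘ suc)
  ... | no ∄P′ = zero , zero∈P ∃P , λ { {zero} _ → irrefl Eq.refl ; {suc y} p → ⊥-elim (∄P′ (y , p)) }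
    where
    zero∈P : ∃ P → zero ∈ P
    zero∈P (zero  , p) = p
    zero∈P (suc i , p) = ⊥-elim (∄P′ (i , p))
  ... | yes ∃P′ with minimum (key ∘ suc) (P? ∘ suc) ∃P′ | P? zero
  ...   | m , pₘ , min | no ¬p₀ = suc m , pₘ , λ { {zero} p → ⊥-elim (¬p₀ p) ; {suc y} → min }
  ...   | m , pₘ , min | yes p₀ with key zero ⊏? key (suc m)
  ...     | yes lt = zero , p₀ , λ { {zero} _ → irrefl Eq.refl ; {suc y} p y⊏0 → min p (⊏-trans y⊏0 lt) }
  ...     | no ¬lt = suc m , pₘ , λ { {zero} _ → ¬lt ; {suc y} → min }

  ascending-chain : {P : Pred (Fin n) ℓ} (key : Fin n → A) → Injective _≡_ _≈_ key →
                    (P? : Decidable P) (r : ℕ) → r ≤ count P? →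
                    ∃ λ (a : Fin r → Fin n) →
                      (∀ i → a i ∈ P) × (∀ {i j} → i Fin.< j → key (a i) ⊏ key (a j))
  ascending-chain key inj P? zero _ = (λ ()) , (λ ()) , λ { {()} }
  ascending-chain {n = n} {P = P} key inj P? (suc r) r<count
    with minimum key P? (0<count⇒∃ P? (≤-trans (s≤s z≤n) r<count))
  ... | x , pₓ , minₓ
    with ascending-chain key inj (P? ∩? ∁? (_≟ x)) r
           (s≤s⁻¹ (subst (suc r ≤_) (count-remove P? pₓ) r<count))
  ... | b , b∈ , b↑ = a , a∈P , a↑
    where
    a : Fin (suc r) → Fin n
    a zero    = x
    a (suc i) = b i

    a∈P : ∀ i → a i ∈ P
    a∈P zero    = pₓ
    a∈P (suc i) = proj₁ (b∈ i)

    x⊏b : ∀ i → key x ⊏ key (b i)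
    x⊏b i with compare (key x) (key (b i))
    ... | tri< lt _ _ = lt
    ... | tri≈ _ eq _ = ⊥-elim (proj₂ (b∈ i) (sym (inj eq)))
    ... | tri> _ _ gt = ⊥-elim (minₓ (proj₁ (b∈ i)) gt)

    a↑ : ∀ {i j} → i Fin.< j → key (a i) ⊏ key (a j)
    a↑ {zero}  {suc j} _   = x⊏b j
    a↑ {suc i} {suc j} i<j = b↑ (s<s⁻¹ i<j)

data Side : Set where
  left right : Side

record Class : Set where
  constructor _,_
  field
    side : Side
    par  : Parity

open Class

next : Class → Class
next (left  , p) = right , p
next (right , p) = left  , p ⁻¹

vertex : Side → Fin n → V (K n)
vertex left  = inj₁
vertex right = inj₂

vertex-injective : ∀ s → Injective _≡_ _≡_ (vertex {n} s)
vertex-injective left  = inj₁-injective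
vertex-injective right = inj₂-injective

vertex≢vertex-next : ∀ X (x y : Fin n) → vertex (side X) x ≢ vertex (side (next X)) y
vertex≢vertex-next (left  , _) x y ()
vertex≢vertex-next (right , _) x y ()

edge : Side → Fin n → Fin n → E (K n)
edge left  x y = x , y
edge right x y = y , x

edge-ends : ∀ X (x y : Fin n) →
            IsEnds (K n) (edge (side X) x y) (vertex (side X) x) (vertex (side (next X)) y)
edge-ends (left  , _) x y = inj₁ (refl , refl)
edge-ends (right , _) x y = inj₂ (refl , refl)

HasParity : Parity → Pred (Fin n) 0ℓ
HasParity p i = parity (toℕ i) ≡ p

hasParity? : ∀ p → Decidable (HasParity {n} p)
hasParity? p i = parity (toℕ i) ℙ.≟ p

weight : E (K n) → ℕ
weight (i , j) with parity (toℕ i) ℙ.≟ parity (toℕ j)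
... | yes _ = toℕ i
... | no  _ = toℕ j

weight-edge : ∀ X {x y : Fin n} → HasParity (par X) x → HasParity (par (next X)) y →
              weight (edge (side X) x y) ≡ toℕ x
weight-edge (left , p) {x} {y} x∈X y∈Y with parity (toℕ x) ℙ.≟ parity (toℕ y)
... | yes _    = refl
... | no  diff = ⊥-elim (diff (trans x∈X (sym y∈Y)))
weight-edge (right , p) {x} {y} x∈X y∈Y with parity (toℕ y) ℙ.≟ parity (toℕ x)
... | yes same = ⊥-elim (p≢p⁻¹ p (trans (sym x∈X) (trans (sym same) y∈Y)))
... | no  _    = refl

parity-suc : ∀ m → parity (suc m) ≡ parity m ⁻¹
parity-suc m = sym (⁻¹-selfInverse (suc-homo-⁻¹ m))

count-hasParity-suc : ∀ p → count (hasParity? {suc n} p ∘ suc) ≡ count (hasParity? {n} (p ⁻¹))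
count-hasParity-suc {n} p = count-cong (hasParity? {suc n} p ∘ suc) (hasParity? {n} (p ⁻¹))
  (λ {i} eq → sym (⁻¹-selfInverse (trans (sym (parity-suc (toℕ i))) eq)))
  (λ {i} eq → trans (parity-suc (toℕ i)) (⁻¹-selfInverse (sym eq)))

count-even : ∀ n → count (hasParity? {n} 0ℙ) ≡ ⌈ n /2⌉
count-odd  : ∀ n → count (hasParity? {n} 1ℙ) ≡ ⌊ n /2⌋
count-even zero    = refl
count-even (suc n) = cong suc (trans (count-hasParity-suc {n} 0ℙ) (count-odd n))
count-odd  zero    = refl
count-odd  (suc n) = trans (count-hasParity-suc {n} 1ℙ) (count-even n)

⌊n/2⌋≤count-hasParity : ∀ n p → ⌊ n /2⌋ ≤ count (hasParity? {n} p)
⌊n/2⌋≤count-hasParity n 0ℙ = subst (⌊ n /2⌋ ≤_) (sym (count-even n)) (⌊n/2⌋≤⌈n/2⌉ n)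
⌊n/2⌋≤count-hasParity n 1ℙ = ≤-reflexive (sym (count-odd n))

module _ {n k : ℕ} (layout : HasPQLayout (K n) weight k) where

  pos : V (K n) → ℕ
  pos = proj₁ layout

  pos-injective : Injective _≡_ _≡_ pos
  pos-injective = proj₁ (proj₂ layout)

  queue : E (K n) → Fin k
  queue = proj₁ (proj₂ (proj₂ layout))

  no-conflict : ∀ (e e' : E (K n)) (u v u' v' : V (K n)) →
                queue e ≡ queue e' → IsEnds (K n) e u v → IsEnds (K n) e' u' v' →
                pos u < pos v → pos u' < pos v → pos v < pos v' → ¬ (weight e' < weight e)
  no-conflict = proj₂ (proj₂ (proj₂ layout))

  Early : Side → ℕ → Pred (Fin n) 0ℓ
  Early s c i = pos (vertex s i) < c

  early? : ∀ s c → Decidable (Early s c)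
  early? s c i = pos (vertex s i) <? c

  placed-before? : ∀ X c → Decidable (HasParity (par X) ∩ Early (side X) c)
  placed-before? X c = hasParity? (par X) ∩? early? (side X) c

  placed-after? : ∀ X c → Decidable (HasParity (par X) ∩ ∁ (Early (side X) c))
  placed-after? X c = hasParity? (par X) ∩? ∁? (early? (side X) c)

  before after : Class → ℕ → ℕ
  before X c = count (placed-before? X c)
  after  X c = count (placed-after? X c)

  after-next≤k : ∀ X c → k < before X c → after (next X) c ≤ k
  after-next≤k X c crowded = ≮⇒≥ staircase
    where
    staircase : ¬ (k < after (next X) c)
    staircase crowded′
      with ascending-chain (Flip.strictTotalOrder <-strictTotalOrder) toℕ toℕ-injective
             (placed-before? X c) (suc k) crowded
         | ascending-chain <-strictTotalOrder (pos ∘ vertex (side (next X)))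
             (vertex-injective (side (next X)) ∘ pos-injective) (placed-after? (next X) c) (suc k) crowded′
    ... | a , a∈ , a↓ | b , b∈ , b↑
      with pigeonhole (n<1+n k) (λ i → queue (edge (side X) (a i) (b i)))
    ... | i , j , i<j , same-queue =
      no-conflict (edge (side X) (a i) (b i)) (edge (side X) (a j) (b j))
        (vertex (side X) (a i)) (vertex (side (next X)) (b i))
        (vertex (side X) (a j)) (vertex (side (next X)) (b j))
        same-queue (edge-ends X (a i) (b i)) (edge-ends X (a j) (b j))
        (early<late i i) (early<late j i) (b↑ i<j)
        (subst₂ _<_ (sym (weight-edge X (proj₁ (a∈ j)) (proj₁ (b∈ j))))
                    (sym (weight-edge X (proj₁ (a∈ i)) (proj₁ (b∈ i))))
                    (a↓ i<j))
      where
      early<late : ∀ i j → pos (vertex (side X) (a i)) < pos (vertex (side (next X)) (b j))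
      early<late i j = <-≤-trans (proj₂ (a∈ i)) (≮⇒≥ (proj₂ (b∈ j)))

  placed-at : ∀ X c → before X c < before X (suc c) → ∃ λ i → pos (vertex (side X) i) ≡ c
  placed-at X c grew with count<count⇒∃ (placed-before? X c) (placed-before? X (suc c)) grew
  ... | i , not-before , pᵢ , before-suc = i , ≤-antisym (s≤s⁻¹ before-suc) (≮⇒≥ (not-before ∘ (pᵢ ,_)))

  module _ (large : ∀ p → suc k + k ≤ count (hasParity? {n} p)) where

    before-next>k : ∀ X c → k < before X c → k < before (next X) c
    before-next>k X c crowded = +-cancelʳ-≤ k (suc k) (before Y c) (begin
      suc k + k                       ≤⟨ large (par Y) ⟩
      count (hasParity? {n} (par Y))  ≡⟨ count-split (hasParity? (par Y)) (early? (side Y) c) ⟩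
      before Y c + after Y c          ≤⟨ +-monoʳ-≤ (before Y c) (after-next≤k X c crowded) ⟩
      before Y c + k                  ∎)
      where
      Y : Class
      Y = next X
      open ≤-Reasoning

    before≤k : ∀ c X → before X c ≤ k
    before≤k zero X = ≮⇒≥ λ crowded →
      n≮0 (proj₂ (proj₂ (0<count⇒∃ (placed-before? X 0) (≤-<-trans z≤n crowded))))
    before≤k (suc c) X = ≮⇒≥ λ crowded →
      clash (placed-at X c (≤-<-trans (before≤k c X) crowded))
            (placed-at (next X) c (≤-<-trans (before≤k c (next X)) (before-next>k X (suc c) crowded)))
      where
      clash : (∃ λ i → pos (vertex (side X) i) ≡ c) → (∃ λ j → pos (vertex (side (next X)) j) ≡ c) → ⊥
      clash (i , pᵢ) (j , pⱼ) = vertex≢vertex-next X i j (pos-injective (trans pᵢ (sym pⱼ)))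

    large-classes⇒⊥ : ⊥
    large-classes⇒⊥ with upper-bound (pos ∘ vertex left)
    ... | M , below = <⇒≱ (≤-trans (m≤m+n (suc k) k) (large 0ℙ)) (begin
      count (hasParity? {n} 0ℙ)  ≤⟨ count-mono (hasParity? 0ℙ) (placed-before? X M) (λ p → p , below _) ⟩
      before X M                 ≤⟨ before≤k M X ⟩
      k                          ∎)
      where
      X : Class
      X = left , 0ℙ
      open ≤-Reasoning

  n≤4k+1 : n ≤ 4 * k + 1
  n≤4k+1 with n ≤? 4 * k + 1
  ... | yes n≤ = n≤
  ... | no  n≰ = ⊥-elim (large-classes⇒⊥ λ p → ≤-trans half (⌊n/2⌋≤count-hasParity n p))
    where
    twice : ∀ k → suc (4 * k + 1) ≡ (suc k + k) + (suc k + k)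
    twice = solve-∀

    half : suc k + k ≤ ⌊ n /2⌋
    half = begin
      suc k + k                        ≡⟨ n≡⌊n+n/2⌋ (suc k + k) ⟩
      ⌊ (suc k + k) + (suc k + k) /2⌋  ≤⟨ ⌊n/2⌋-mono (subst (_≤ n) (twice k) (≰⇒> n≰)) ⟩
      ⌊ n /2⌋                          ∎
      where open ≤-Reasoning

  0<k : 0 < n → 0 < k
  0<k 0<n = >-nonZero⁻¹ k ⦃ nonZeroIndex (queue (i , i)) ⦄
    where
    i : Fin n
    i = fromℕ< 0<n

n≤5k⇒GeConst : ∀ n k → n ≤ 5 * k → GeConst n k
n≤5k⇒GeConst n k n≤5k = *-cancelˡ-≤ 25 (begin
  25 * d ^ 2           ≡⟨ scale² 5 d ⟨
  (5 * d) ^ 2          ≤⟨ ^-monoˡ-≤ 2 5d≤11n ⟩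
  (11 * n) ^ 2         ≡⟨ scale² 11 n ⟩
  121 * n ^ 2          ≤⟨ *-monoˡ-≤ (n ^ 2) (m≤m+n 121 4) ⟩
  125 * n ^ 2          ≡⟨ *-assoc 25 5 (n ^ 2) ⟩
  25 * (5 * n ^ 2)     ∎)
  where
  open ≤-Reasoning

  -- x ^ 2 unfolded to x * (x * 1), the form the ring solver accepts
  scale² : ∀ a x → (a * x) * ((a * x) * 1) ≡ (a * a) * (x * (x * 1))
  scale² = solve-∀

  d : ℕ
  d = 3 * n ∸ 4 * k

  5d≤11n : 5 * d ≤ 11 * n
  5d≤11n = begin
    5 * (3 * n ∸ 4 * k)        ≡⟨ *-distribˡ-∸ 5 (3 * n) (4 * k) ⟩
    5 * (3 * n) ∸ 5 * (4 * k)  ≤⟨ ∸-monoʳ-≤ (5 * (3 * n)) 4n≤20k ⟩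
    5 * (3 * n) ∸ 4 * n        ≡⟨ cong (_∸ 4 * n) (trans (sym (*-assoc 5 3 n)) (*-distribʳ-+ n 11 4)) ⟩
    11 * n + 4 * n ∸ 4 * n     ≡⟨ m+n∸n≡m (11 * n) (4 * n) ⟩
    11 * n                     ∎
    where
    4n≤20k : 4 * n ≤ 5 * (4 * k)
    4n≤20k = subst (4 * n ≤_) (trans (sym (*-assoc 4 5 k)) (*-assoc 5 4 k)) (*-monoʳ-≤ 4 n≤5k)

theorem3p3 : ∀ (n : ℕ) → 1 ≤ n → ∀ (m : ℕ) → IsCeilConst n m →
    ∀ (k : ℕ) → PqnAtMost (K n) k → m ≤ k
theorem3p3 n 1≤n m (_ , m-least) k pqn≤k = m-least k (n≤5k⇒GeConst n k (begin
  n          ≤⟨ n≤4k+1 layout ⟩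
  4 * k + 1  ≤⟨ +-monoʳ-≤ (4 * k) (0<k layout 1≤n) ⟩
  4 * k + k  ≡⟨ +-comm (4 * k) k ⟩
  5 * k      ∎))
  where
  layout : HasPQLayout (K n) weight k
  layout = pqn≤k weight
  open ≤-Reasoning
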